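{- Let $G$ be a connected graph and let $S\subseteq V(G)$. The following statements are equivalent: (1) there is a GS ordering of $G$ whose $\mathcal{F}$-tree has all elements of $S$ as leaves; (2) there is a spanning tree of $G$ in which all elements of $S$ are leaves; (3) the set $V(G)\setminus S$ forms a connected dominating set of $G$.
   Context: All graphs are finite, simple, undirected, connected and non-empty. A GS (Generic Search) ordering of $G$ is an ordering $(v_1,\dots,v_n)$ of all vertices in which every $v_i$ with $i>1$ is adjacent to some $v_j$ with $j<i$. The $\mathcal{F}$-tree of $\sigma=(v_1,\dots,v_n)$ is the spanning tree rooted at $v_1$ in which, for $i>1$, the parent of $v_i$ is its leftmost neighbor in $\sigma$. Spanning trees are considered rooted; a leaf is a vertex with no children, and the root is never counted as a leaf. A connected dominating set is a set $D$ such that $G[D]$ is connected and every vertex not in $D$ has a neighbor in $D$. -}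

module Defs where

open import Data.Nat using (ℕ; zero; suc)
open import Data.Fin using (Fin; _<_)
open import Data.Fin.Subset using (Subset; _∈_; _∉_; ∁; Nonempty)
open import Data.Fin.Permutation using (Permutation′; _⟨$⟩ʳ_)
open import Data.Bool using (Bool; true; false)
open import Data.Product using (Σ; ∃; _×_; _,_)
open import Relation.Binary.PropositionalEquality using (_≡_; _≢_)
open import Relation.Nullary using (¬_)

record Graph (n : ℕ) : Set where
  field
    adj   : Fin n → Fin n → Bool
    sym   : ∀ u v → adj u v ≡ adj v u
    irrefl : ∀ v → adj v v ≡ false

open Graph public

Adj : ∀ {n} → Graph n → Fin n → Fin n → Set
Adj G u v = adj G u v ≡ true

data ReachIn {n} (G : Graph n) (D : Subset n) : Fin n → Fin n → Set where
  here : ∀ {u} → u ∈ D → ReachIn G D u u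
  step : ∀ {u v w} → u ∈ D → Adj G u v → ReachIn G D v w → ReachIn G D u w

-- G[D] is connected (connected graphs are non-empty).
InducedConnected : ∀ {n} → Graph n → Subset n → Set
InducedConnected G D = Nonempty D × (∀ u v → u ∈ D → v ∈ D → ReachIn G D u v)

full : ∀ {n} → Subset n
full {n} = ∁ (Data.Fin.Subset.⊥)

Connected : ∀ {n} → Graph n → Set
Connected G = InducedConnected G full

IsCDS : ∀ {n} → Graph n → Subset n → Set
IsCDS G D = InducedConnected G D × (∀ v → v ∉ D → ∃ λ u → u ∈ D × Adj G v u)

iter : ∀ {n} → (Fin n → Fin n) → ℕ → Fin n → Fin n
iter p zero v = v
iter p (suc k) v = p (iter p k v)

record RootedSpanningTree {n} (G : Graph n) : Set where
  field
    root   : Fin n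
    parent : Fin n → Fin n
    parentAdj : ∀ v → v ≢ root → Adj G v (parent v)
    reachesRoot : ∀ v → ∃ λ k → iter parent k v ≡ root

open RootedSpanningTree public

ChildOf : ∀ {n} {G : Graph n} → RootedSpanningTree G → Fin n → Fin n → Set
ChildOf T u v = u ≢ root T × parent T u ≡ v

IsLeaf : ∀ {n} {G : Graph n} → RootedSpanningTree G → Fin n → Set
IsLeaf T v = v ≢ root T × (∀ u → ¬ ChildOf T u v)

-- GS orderings: σ ⟨$⟩ʳ i is the i-th vertex v_i (positions are Fin n).

IsGS : ∀ {n} → Graph n → Permutation′ n → Set
IsGS {n} G σ = ∀ (i : Fin n) → (∃ λ (j : Fin n) → j < i) →
  ∃ λ (j : Fin n) → j < i × Adj G (σ ⟨$⟩ʳ i) (σ ⟨$⟩ʳ j)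

-- In the F-tree of σ, the vertex at position i is a child of the vertex
-- at position j: i is not the first position and σ_j is the leftmost
-- neighbour of σ_i in σ.
FChild : ∀ {n} → Graph n → Permutation′ n → Fin n → Fin n → Set
FChild {n} G σ i j = (∃ λ (k : Fin n) → k < i)
  × Adj G (σ ⟨$⟩ʳ i) (σ ⟨$⟩ʳ j)
  × (∀ (k : Fin n) → k < j → ¬ Adj G (σ ⟨$⟩ʳ i) (σ ⟨$⟩ʳ k))

-- σ_j is a leaf of the F-tree: not the root (position 0) and no children.
IsFLeaf : ∀ {n} → Graph n → Permutation′ n → Fin n → Set
IsFLeaf {n} G σ j = (∃ λ (k : Fin n) → k < j) × (∀ (i : Fin n) → ¬ FChild G σ i j)

IsFLeafVertex : ∀ {n} → Graph n → Permutation′ n → Fin n → Set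
IsFLeafVertex G σ v = ∃ λ j → σ ⟨$⟩ʳ j ≡ v × IsFLeaf G σ j

-- (1) ⇒ (2): the F-tree is a spanning tree, and its leaves are leaves.
-- (2) ⇒ (3): the non-leaves of a rooted spanning tree contain the root and
-- every parent, so each of them walks to the root through non-leaves, and
-- every leaf is adjacent to its parent.
-- (3) ⇒ (1): search the connected dominating set D = V ∖ S first, starting
-- from any vertex of D and always appending a vertex of D adjacent to the
-- prefix. By connectivity this prefix eventually contains all of D, and by
-- domination every later vertex has a neighbour in it. Hence every non-first
-- vertex has its leftmost neighbour in the prefix, so no vertex of S is a parent
-- in the F-tree.
module Submission where

open import Defs hiding (sym)
open import Level using (0ℓ)
open import Data.Nat using (ℕ; zero; suc; z≤n; s≤s; _+_)
  renaming (_<_ to _<ℕ_; _≤_ to _≤ℕ_; _<?_ to _<ℕ?_)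
open import Data.Nat.Properties
  using (≮⇒≥; <-trans; <-≤-trans; ≤-<-trans; <-irrefl; m<1+n⇒m<n∨m≡n; +-suc; +-identityʳ; _≤?_)
open import Data.Fin using (Fin; zero; suc; toℕ; fromℕ<; _<_; _≟_)
open import Data.Fin.Properties using (toℕ<n; toℕ-fromℕ<; toℕ-injective; any?)
open import Data.Fin.Induction using (<-wellFounded)
open import Data.Fin.Subset using (Subset; _∈_; _∉_; ∁)
open import Data.Fin.Subset.Properties using (_∈?_; x∈p⇒x∉∁p; x∉p⇒x∈∁p)
open import Data.Fin.Permutation using (Permutation′; _⟨$⟩ʳ_; _⟨$⟩ˡ_; inverseˡ; inverseʳ; transpose; _∘ₚ_)
import Data.Fin.Permutation.Components as PC
open import Data.Bool using (true)
import Data.Bool as Bool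
open import Data.Product using (∃; ∃₂; _×_; _,_; proj₁; proj₂)
open import Data.Sum using (_⊎_; inj₁; inj₂)
open import Data.Empty using (⊥-elim)
open import Induction.WellFounded using (module All)
open import Relation.Nullary using (¬_; Dec; yes; no)
open import Relation.Nullary.Decidable using (_×-dec_)
open import Relation.Unary using (Decidable)
open import Relation.Binary.PropositionalEquality
  using (_≡_; _≢_; refl; sym; trans; cong; subst; subst₂)
open import Function.Base using (_∘′_)
open import Function.Bundles using (_⇔_; mk⇔)

adj-sym : ∀ {n} (G : Graph n) {u v} → Adj G u v → Adj G v u
adj-sym G {u} {v} = trans (Graph.sym G v u)

adj? : ∀ {n} (G : Graph n) u v → Dec (Adj G u v)
adj? G u v = adj G u v Bool.≟ true

⟨$⟩ʳ-injective : ∀ {n} (σ : Permutation′ n) {i j} → σ ⟨$⟩ʳ i ≡ σ ⟨$⟩ʳ j → i ≡ j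
⟨$⟩ʳ-injective σ {i} {j} eq =
  trans (sym (inverseˡ σ)) (trans (cong (σ ⟨$⟩ˡ_) eq) (inverseˡ σ))

transpose-matchˡ : ∀ {n} (i j : Fin n) → PC.transpose i j i ≡ j
transpose-matchˡ i j with i ≟ i
... | yes _   = refl
... | no i≢i = ⊥-elim (i≢i refl)

transpose-fixes : ∀ {n} {i j k : Fin n} → k ≢ i → k ≢ j → PC.transpose i j k ≡ k
transpose-fixes {i = i} {j} {k} k≢i k≢j with k ≟ i
... | yes k≡i = ⊥-elim (k≢i k≡i)
... | no _ with k ≟ j
...   | yes k≡j = ⊥-elim (k≢j k≡j)
...   | no _    = refl

iter-suc : ∀ {n} (p : Fin n → Fin n) k v → iter p (suc k) v ≡ iter p k (p v)
iter-suc p zero    v = refl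
iter-suc p (suc k) v = cong p (iter-suc p k v)

Minimal : ∀ {n} → (Fin n → Set) → Fin n → Set
Minimal P i = P i × (∀ j → j < i → ¬ P j)

none⊎minimal : ∀ {n} {P : Fin n → Set} → Decidable P → (∀ i → ¬ P i) ⊎ ∃ (Minimal P)
none⊎minimal {zero}  P? = inj₁ λ ()
none⊎minimal {suc n} P? with P? zero
... | yes p₀ = inj₂ (zero , p₀ , λ _ ())
... | no ¬p₀ with none⊎minimal (λ i → P? (suc i))
...   | inj₁ none = inj₁ λ { zero → ¬p₀ ; (suc i) → none i }
...   | inj₂ (i , pᵢ , before) =
        inj₂ (suc i , pᵢ , λ { zero _ → ¬p₀ ; (suc j) (s≤s j<i) → before j j<i })

module _ {n} {G : Graph n} {D : Subset n} where

  reach-source : ∀ {u w} → ReachIn G D u w → u ∈ D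
  reach-source (here u∈D)     = u∈D
  reach-source (step u∈D _ _) = u∈D

  reach-++ : ∀ {u v w} → ReachIn G D u v → ReachIn G D v w → ReachIn G D u w
  reach-++ (here _)       q = q
  reach-++ (step u∈D a p) q = step u∈D a (reach-++ p q)

  reach-sym : ∀ {u w} → ReachIn G D u w → ReachIn G D w u
  reach-sym (here u∈D)     = here u∈D
  reach-sym (step u∈D a p) =
    reach-++ (reach-sym p) (step (reach-source p) (adj-sym G a) (here u∈D))

  reach-preserves : (Q : Fin n → Set) →
    (∀ {x y} → x ∈ D → y ∈ D → Adj G x y → Q x → Q y) →
    ∀ {u w} → ReachIn G D u w → Q u → Q w
  reach-preserves Q closed (here _)       q = q
  reach-preserves Q closed (step u∈D a p) q =
    reach-preserves Q closed p (closed u∈D (reach-source p) a q)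

SpanningTreeWithLeaves : ∀ {n} → Graph n → Subset n → Set
SpanningTreeWithLeaves G S = ∃ λ (T : RootedSpanningTree G) → ∀ v → v ∈ S → IsLeaf T v

GSOrderingWithLeaves : ∀ {n} → Graph n → Subset n → Set
GSOrderingWithLeaves {n} G S =
  ∃ λ (σ : Permutation′ n) → IsGS G σ × (∀ v → v ∈ S → IsFLeafVertex G σ v)

module _ {n} {G : Graph n} (T : RootedSpanningTree G) {D : Subset n}
         (root∈D : root T ∈ D) (parent∈D : ∀ v → v ≢ root T → parent T v ∈ D) where

  reachRootWithin : ∀ k u → u ∈ D → iter (parent T) k u ≡ root T → ReachIn G D u (root T)
  reachRootWithin zero    u u∈D eq = subst (ReachIn G D u) eq (here u∈D)
  reachRootWithin (suc k) u u∈D eq with u ≟ root T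
  ... | yes refl = here u∈D
  ... | no u≢r   = step u∈D (parentAdj T u u≢r)
    (reachRootWithin k (parent T u) (parent∈D u u≢r) (trans (sym (iter-suc (parent T) k u)) eq))

  parentClosed⇒isCDS : IsCDS G D
  parentClosed⇒isCDS = ((root T , root∈D) , connected) , dominated
    where
    toRoot : ∀ u → u ∈ D → ReachIn G D u (root T)
    toRoot u u∈D = let (k , eq) = reachesRoot T u in reachRootWithin k u u∈D eq

    connected : ∀ u v → u ∈ D → v ∈ D → ReachIn G D u v
    connected u v u∈D v∈D = reach-++ (toRoot u u∈D) (reach-sym (toRoot v v∈D))

    dominated : ∀ v → v ∉ D → ∃ λ u → u ∈ D × Adj G v u
    dominated v v∉D = parent T v , parent∈D v v≢r , parentAdj T v v≢r
      where
      v≢r : v ≢ root T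
      v≢r refl = v∉D root∈D

treeLeaves⇒isCDS : ∀ {n} {G : Graph n} {S : Subset n} →
  SpanningTreeWithLeaves G S → IsCDS G (∁ S)
treeLeaves⇒isCDS {S = S} (T , leaf) = parentClosed⇒isCDS T root∈∁S parent∈∁S
  where
  root∈∁S : root T ∈ ∁ S
  root∈∁S = x∉p⇒x∈∁p λ r∈S → proj₁ (leaf _ r∈S) refl

  parent∈∁S : ∀ v → v ≢ root T → parent T v ∈ ∁ S
  parent∈∁S v v≢r = x∉p⇒x∈∁p λ p∈S → proj₂ (leaf _ p∈S) v (v≢r , refl)

module FTree {m} {G : Graph (suc m)} (σ : Permutation′ (suc m)) (gs : IsGS G σ) where

  LeftmostNeighbour : Fin (suc m) → Fin (suc m) → Set
  LeftmostNeighbour v = Minimal λ j → Adj G v (σ ⟨$⟩ʳ j)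

  parentFrom : ∀ v → (∀ j → ¬ Adj G v (σ ⟨$⟩ʳ j)) ⊎ ∃ (LeftmostNeighbour v) → Fin (suc m)
  parentFrom v (inj₁ _)       = v   -- junk: a vertex without neighbours can only be the root
  parentFrom v (inj₂ (j , _)) = σ ⟨$⟩ʳ j

  fParent : Fin (suc m) → Fin (suc m)
  fParent v = parentFrom v (none⊎minimal λ j → adj? G v (σ ⟨$⟩ʳ j))

  fParent-leftmost : ∀ i → (∃ λ (j : Fin (suc m)) → j < i) →
    ∃ λ k → k < i × LeftmostNeighbour (σ ⟨$⟩ʳ i) k × fParent (σ ⟨$⟩ʳ i) ≡ σ ⟨$⟩ʳ k
  fParent-leftmost i notFirst with gs i notFirst | none⊎minimal (λ j → adj? G (σ ⟨$⟩ʳ i) (σ ⟨$⟩ʳ j))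
  ... | j , j<i , a | inj₁ none = ⊥-elim (none j a)
  ... | j , j<i , a | inj₂ (k , leftmost@(_ , before)) =
    k , ≤-<-trans (≮⇒≥ λ j<k → before j j<k a) j<i , leftmost , refl

  notFirst : ∀ i → σ ⟨$⟩ʳ i ≢ σ ⟨$⟩ʳ zero → ∃ λ (j : Fin (suc m)) → j < i
  notFirst zero    ne = ⊥-elim (ne refl)
  notFirst (suc i) _  = zero , s≤s z≤n

  atPosition : (P : Fin (suc m) → Set) → (∀ i → P (σ ⟨$⟩ʳ i)) → ∀ v → P v
  atPosition P p v = subst P (inverseʳ σ) (p (σ ⟨$⟩ˡ v))

  reachesFirst : ∀ i → ∃ λ t → iter fParent t (σ ⟨$⟩ʳ i) ≡ σ ⟨$⟩ʳ zero
  reachesFirst = All.wfRec <-wellFounded 0ℓ _ λ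
    { zero    _   → 0 , refl
    ; (suc i) rec →
        let (k , k<i , _ , eq) = fParent-leftmost (suc i) (zero , s≤s z≤n)
            (t , reached)      = rec k<i
        in suc t , trans (iter-suc fParent t _) (trans (cong (iter fParent t) eq) reached) }

  fTree : RootedSpanningTree G
  fTree = record
    { root        = σ ⟨$⟩ʳ zero
    ; parent      = fParent
    ; parentAdj   = atPosition _ λ i ne →
        let (k , _ , (a , _) , eq) = fParent-leftmost i (notFirst i ne)
        in subst (Adj G _) (sym eq) a
    ; reachesRoot = atPosition _ reachesFirst
    }

  fLeaf⇒leaf : ∀ v → IsFLeafVertex G σ v → IsLeaf fTree v
  fLeaf⇒leaf _ (j , refl , (k , k<j) , childless) = notRoot , atPosition _ noChild
    where
    notRoot : σ ⟨$⟩ʳ j ≢ σ ⟨$⟩ʳ zero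
    notRoot eq with ⟨$⟩ʳ-injective σ eq
    notRoot eq | refl = ⊥-elim (<-irrefl refl (<-≤-trans k<j z≤n))

    noChild : ∀ i → ¬ ChildOf fTree (σ ⟨$⟩ʳ i) (σ ⟨$⟩ʳ j)
    noChild i (ne , isParent) with fParent-leftmost i (notFirst i ne)
    ... | k , _ , leftmost , eq with ⟨$⟩ʳ-injective σ (trans (sym eq) isParent)
    ...   | refl = childless i (notFirst i ne , leftmost)

gsLeaves⇒treeLeaves : ∀ {n} {G : Graph n} {S : Subset n} → Connected G →
  GSOrderingWithLeaves G S → SpanningTreeWithLeaves G S
gsLeaves⇒treeLeaves {zero}  ((() , _) , _) _
gsLeaves⇒treeLeaves {suc m} {G} _ (σ , gs , fLeaf) =
  fTree , λ v v∈S → fLeaf⇒leaf v (fLeaf v v∈S)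
  where open FTree {G = G} σ gs

module PrefixSearch {m} (G : Graph (suc m)) (D : Subset (suc m)) where

  Searched : Permutation′ (suc m) → Fin (suc m) → Set
  Searched π i = (∃ λ (j : Fin (suc m)) → j < i) → ∃ λ j → j < i × Adj G (π ⟨$⟩ʳ i) (π ⟨$⟩ʳ j)

  record SearchPrefix (k : ℕ) (π : Permutation′ (suc m)) : Set where
    field
      nonempty : 0 <ℕ k
      inside   : ∀ i → toℕ i <ℕ k → π ⟨$⟩ʳ i ∈ D
      searched : ∀ i → toℕ i <ℕ k → Searched π i

  Frontier : ℕ → Permutation′ (suc m) → Set
  Frontier k π = ∃ λ p → k ≤ℕ toℕ p × π ⟨$⟩ʳ p ∈ D ×
    ∃ λ j → toℕ j <ℕ k × Adj G (π ⟨$⟩ʳ p) (π ⟨$⟩ʳ j)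

  frontier? : ∀ k π → Dec (Frontier k π)
  frontier? k π = any? λ p → (k ≤? toℕ p) ×-dec (π ⟨$⟩ʳ p ∈? D)
    ×-dec any? λ j → (toℕ j <ℕ? k) ×-dec adj? G (π ⟨$⟩ʳ p) (π ⟨$⟩ʳ j)

  Exhaustive : ℕ → Permutation′ (suc m) → Set
  Exhaustive k π = ∀ i → π ⟨$⟩ʳ i ∈ D → toℕ i <ℕ k

  singletonPrefix : ∀ {r} → r ∈ D → SearchPrefix 1 (transpose zero r)
  singletonPrefix {r} r∈D = record
    { nonempty = s≤s z≤n
    ; inside   = λ { zero _ → subst (_∈ D) (sym (transpose-matchˡ zero r)) r∈D
                   ; (suc _) (s≤s ()) }
    ; searched = λ { zero _ (_ , ()) ; (suc _) (s≤s ()) }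
    }

  extendPrefix : ∀ {k π} → SearchPrefix k π → Frontier k π → ∃ (SearchPrefix (suc k))
  extendPrefix {k} {π} P (p , k≤p , p∈D , j , j<k , a) =
    π′ , record { nonempty = s≤s z≤n ; inside = inside′ ; searched = searched′ }
    where
    open SearchPrefix P
    k<n : k <ℕ suc m
    k<n = ≤-<-trans k≤p (toℕ<n p)
    kF : Fin (suc m)
    kF = fromℕ< k<n
    π′ : Permutation′ (suc m)
    π′ = transpose kF p ∘ₚ π

    unchanged : ∀ i → toℕ i <ℕ k → π′ ⟨$⟩ʳ i ≡ π ⟨$⟩ʳ i
    unchanged i i<k = cong (π ⟨$⟩ʳ_) (transpose-fixes
      (λ { refl → <-irrefl (toℕ-fromℕ< k<n) i<k })
      (λ { refl → <-irrefl refl (<-≤-trans i<k k≤p) }))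

    appended : π′ ⟨$⟩ʳ kF ≡ π ⟨$⟩ʳ p
    appended = cong (π ⟨$⟩ʳ_) (transpose-matchˡ kF p)

    below-or-new : ∀ i → toℕ i <ℕ suc k → toℕ i <ℕ k ⊎ i ≡ kF
    below-or-new i i<1+k with m<1+n⇒m<n∨m≡n i<1+k
    ... | inj₁ i<k = inj₁ i<k
    ... | inj₂ i≡k = inj₂ (toℕ-injective (trans i≡k (sym (toℕ-fromℕ< k<n))))

    inside′ : ∀ i → toℕ i <ℕ suc k → π′ ⟨$⟩ʳ i ∈ D
    inside′ i i<1+k with below-or-new i i<1+k
    ... | inj₁ i<k  = subst (_∈ D) (sym (unchanged i i<k)) (inside i i<k)
    ... | inj₂ refl = subst (_∈ D) (sym appended) p∈D

    searched′ : ∀ i → toℕ i <ℕ suc k → Searched π′ i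
    searched′ i i<1+k notFirst with below-or-new i i<1+k
    ... | inj₁ i<k =
      let (j′ , j′<i , a′) = searched i i<k notFirst
      in j′ , j′<i , subst₂ (Adj G) (sym (unchanged i i<k)) (sym (unchanged j′ (<-trans j′<i i<k))) a′
    ... | inj₂ refl =
      j , subst (toℕ j <ℕ_) (sym (toℕ-fromℕ< k<n)) j<k
        , subst₂ (Adj G) (sym appended) (sym (unchanged j j<k)) a

  blocked⇒exhaustive : (∀ u v → u ∈ D → v ∈ D → ReachIn G D u v) →
    ∀ {k π} → SearchPrefix k π → ¬ Frontier k π → Exhaustive k π
  blocked⇒exhaustive connected {k} {π} P blocked i πi∈D =
    subst (λ i → toℕ i <ℕ k) (inverseˡ π)
      (reach-preserves InPrefix closed (connected _ _ (inside zero nonempty) πi∈D)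
        (subst (λ i → toℕ i <ℕ k) (sym (inverseˡ π)) nonempty))
    where
    open SearchPrefix P
    InPrefix : Fin (suc m) → Set
    InPrefix v = toℕ (π ⟨$⟩ˡ v) <ℕ k

    closed : ∀ {x y} → x ∈ D → y ∈ D → Adj G x y → InPrefix x → InPrefix y
    closed {x} {y} _ y∈D a x∈P with toℕ (π ⟨$⟩ˡ y) <ℕ? k
    ... | yes y∈P = y∈P
    ... | no y∉P  = ⊥-elim (blocked
      ( π ⟨$⟩ˡ y , ≮⇒≥ y∉P , subst (_∈ D) (sym (inverseʳ π)) y∈D
      , π ⟨$⟩ˡ x , x∈P , subst₂ (Adj G) (sym (inverseʳ π)) (sym (inverseʳ π)) (adj-sym G a)))

  exhaustivePrefix : (∀ u v → u ∈ D → v ∈ D → ReachIn G D u v) →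
    ∀ f {k π} → SearchPrefix k π → k + f ≡ suc m →
    ∃₂ λ k π → SearchPrefix k π × Exhaustive k π
  exhaustivePrefix connected zero {k} {π} P k+0≡n =
    k , π , P , λ i _ → subst (toℕ i <ℕ_) (sym (trans (sym (+-identityʳ k)) k+0≡n)) (toℕ<n i)
  exhaustivePrefix connected (suc f) {k} {π} P k+1+f≡n with frontier? k π
  ... | no blocked = k , π , P , blocked⇒exhaustive connected P blocked
  ... | yes F      = let (π′ , P′) = extendPrefix P F in
    exhaustivePrefix connected f P′ (trans (sym (+-suc k f)) k+1+f≡n)

  module _ {k π} (P : SearchPrefix k π) (exhaustive : Exhaustive k π)
           (dominated : ∀ v → v ∉ D → ∃ λ u → u ∈ D × Adj G v u) where
    open SearchPrefix P

    earlierPrefixNeighbour : ∀ i → (∃ λ (j : Fin (suc m)) → j < i) →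
      ∃ λ j → j < i × toℕ j <ℕ k × Adj G (π ⟨$⟩ʳ i) (π ⟨$⟩ʳ j)
    earlierPrefixNeighbour i notFirst with toℕ i <ℕ? k
    ... | yes i<k = let (j , j<i , a) = searched i i<k notFirst in j , j<i , <-trans j<i i<k , a
    ... | no i≮k with dominated (π ⟨$⟩ʳ i) (λ πi∈D → i≮k (exhaustive i πi∈D))
    ...   | u , u∈D , a = π ⟨$⟩ˡ u , <-≤-trans j<k (≮⇒≥ i≮k) , j<k
                        , subst (Adj G _) (sym (inverseʳ π)) a
      where
      j<k : toℕ (π ⟨$⟩ˡ u) <ℕ k
      j<k = exhaustive _ (subst (_∈ D) (sym (inverseʳ π)) u∈D)

    isGS : IsGS G π
    isGS i notFirst = let (j , j<i , _ , a) = earlierPrefixNeighbour i notFirst in j , j<i , a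

    outside⇒fLeaf : ∀ v → v ∉ D → IsFLeafVertex G π v
    outside⇒fLeaf v v∉D = π ⟨$⟩ˡ v , inverseʳ π , (zero , <-≤-trans nonempty k≤j) , noChild
      where
      k≤j : k ≤ℕ toℕ (π ⟨$⟩ˡ v)
      k≤j = ≮⇒≥ λ j<k → v∉D (subst (_∈ D) (inverseʳ π) (inside _ j<k))

      noChild : ∀ i → ¬ FChild G π i (π ⟨$⟩ˡ v)
      noChild i (notFirst , _ , before) =
        let (j , _ , j<k , a) = earlierPrefixNeighbour i notFirst in before j (<-≤-trans j<k k≤j) a

cds⇒gsLeaves : ∀ {n} {G : Graph n} {S : Subset n} → IsCDS G (∁ S) → GSOrderingWithLeaves G S
cds⇒gsLeaves {zero}  (((() , _) , _) , _)
cds⇒gsLeaves {suc m} {G} {S} (((r , r∈D) , connected) , dominated) =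
  let (k , π , P , exhaustive) = exhaustivePrefix connected m (singletonPrefix r∈D) refl
  in π , isGS P exhaustive dominated
       , λ v v∈S → outside⇒fLeaf P exhaustive dominated v (x∈p⇒x∉∁p v∈S)
  where open PrefixSearch G (∁ S)

theorem3p5 : ∀ {n} (G : Graph n) → Connected G → (S : Subset n) →
    ((∃ λ (σ : Permutation′ n) → IsGS G σ × (∀ v → v ∈ S → IsFLeafVertex G σ v))
      ⇔ (∃ λ (T : RootedSpanningTree G) → ∀ v → v ∈ S → IsLeaf T v))
    × ((∃ λ (T : RootedSpanningTree G) → ∀ v → v ∈ S → IsLeaf T v)
      ⇔ IsCDS G (∁ S))
theorem3p5 G connected S =
  mk⇔ (gsLeaves⇒treeLeaves connected) (cds⇒gsLeaves ∘′ treeLeaves⇒isCDS) ,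
  mk⇔ treeLeaves⇒isCDS (gsLeaves⇒treeLeaves connected ∘′ cds⇒gsLeaves)
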